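{- For every $\ell$ there is $s=s(\ell)$ such that the following holds. Suppose $G$ is a graph, $C_1,C_2\subseteq G$ are vertex-disjoint, $C_1$ is an $s$-blob cycle, $C_2$ is a $5$-blob cycle, and every vertex of the blob of $C_2$ has at least $\lfloor |V(C_1)|/2\rfloor-\ell$ neighbours on $C_1$. Then there exists an $s'$-blob cycle $C\subseteq G$ with $s'\ge s-2$, $V(C)=V(C_1)\cup V(C_2)$, and the blob of $C$ contained in the blob of $C_1$.
   Context: An $s$-blob cycle is the union of a cycle with a clique on $s$ consecutive vertices of that cycle; this set of $s$ clique vertices is called the blob. -}

module Defs where

open import Data.Nat using (ℕ; zero; suc; _≤_; _<_; _∸_; _/_)
open import Data.Fin using (Fin; toℕ)
open import Data.Product using (Σ; ∃; ∃-syntax; _×_; _,_)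
open import Data.Sum using (_⊎_)
open import Data.Empty using (⊥)
open import Relation.Nullary using (¬_)
open import Relation.Binary.PropositionalEquality using (_≡_; _≢_)
open import Function.Definitions using (Injective)

record Graph (V : Set) : Set₁ where
  field
    Adj   : V → V → Set
    sym   : ∀ {u v} → Adj u v → Adj v u
    irrefl : ∀ {v} → ¬ Adj v v
open Graph public

CycNext : {k : ℕ} → Fin k → Fin k → Set
CycNext {k} i j = (suc (toℕ i) ≡ toℕ j) ⊎ (suc (toℕ i) ≡ k × toℕ j ≡ 0)

-- The cycle is the sequence of distinct vertices vert 0, ..., vert (k-1)
-- (k ≥ 3), and the blob is the set of the first s positions (s consecutive
-- vertices of the cycle; every cyclic window can be rotated to the front).
record BlobCycle {V : Set} (G : Graph V) (s : ℕ) : Set where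
  field
    len      : ℕ
    len≥3    : 3 ≤ len
    s≤len    : s ≤ len
    vert     : Fin len → V
    distinct : Injective _≡_ _≡_ vert
    cycEdge  : ∀ (i j : Fin len) → CycNext i j → Adj G (vert i) (vert j)
    blobClique : ∀ (i j : Fin len) → toℕ i < s → toℕ j < s → i ≢ j →
                 Adj G (vert i) (vert j)
open BlobCycle public

_∈V_ : {V : Set} {G : Graph V} {s : ℕ} → V → BlobCycle G s → Set
v ∈V C = ∃[ i ] vert C i ≡ v

_∈Blob_ : {V : Set} {G : Graph V} {s : ℕ} → V → BlobCycle G s → Set
_∈Blob_ {s = s} v C = ∃[ i ] (toℕ i < s × vert C i ≡ v)

VDisjoint : {V : Set} {G : Graph V} {s t : ℕ} → BlobCycle G s → BlobCycle G t → Set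
VDisjoint C D = ∀ v → v ∈V C → v ∈V D → ⊥

AtLeastNbrsOn : {V : Set} (G : Graph V) {s : ℕ} → ℕ → V → BlobCycle G s → Set
AtLeastNbrsOn G m v C =
  Σ (Fin m → Fin (len C)) λ g → Injective _≡_ _≡_ g × (∀ i → Adj G v (vert C (g i)))

-- Let n = |C₁|, σ = s - 1, and let x₀, x₁, x₂ be the interior blob vertices of
-- C₂ (positions 1, 2, 3); each has ≥ m = ⌊n/2⌋ - ℓ neighbours on C₁.  Either
--  (E) xᵢ ~ C₁[q], xⱼ ~ C₁[q+1] (i ≠ j) for an edge q → q+1 of the outer path
--      σ, …, n-1, 0 of C₁: splice C₂ into that edge, keeping the blob; or
--  (I) xᵢ ~ C₁[u], xⱼ ~ C₁[v] (i ≠ j) for distinct interior blob positions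
--      u, v: permute the blob so that u, v become s-3, s-2 and splice there,
--      losing two blob vertices.
-- In both cases C₂ is first permuted inside its blob so that xᵢ, xⱼ sit at the
-- adjacent positions 3, 2, and is traversed from xᵢ round to xⱼ.
-- To find (E) or (I), every incidence (colour i, neighbour position p) gets a
-- slot below s + 3 + ⌊3(n-σ)/2⌋ such that a shared slot forces (E) or (I);
-- this bound is less than 3m, so the pigeonhole principle concludes.

module Submission where

open import Defs
open import Data.Nat using (ℕ; _≤_; _<_; _∸_; _/_)
open import Data.Fin using (Fin; toℕ)
open import Data.Product using (Σ; ∃-syntax; _×_)
open import Data.Sum using (_⊎_)
open import Function.Bundles using (_⇔_)

open import Data.Nat
open import Data.Nat.Properties
open import Data.Nat.DivMod
open import Data.Fin using (fromℕ<; remQuot; combine)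
open import Data.Fin.Properties
  using (toℕ<n; toℕ-fromℕ<; fromℕ<-toℕ; fromℕ<-cong; toℕ-injective; pigeonhole; combine-remQuot)
open import Data.Product using (_,_; proj₁; proj₂; ∃₂; uncurry)
open import Data.Sum using (inj₁; inj₂; [_,_])
open import Data.Empty using (⊥; ⊥-elim)
open import Relation.Nullary using (yes; no)
open import Relation.Binary using (tri<; tri≈; tri>)
open import Relation.Binary.PropositionalEquality as ≡
  using (_≡_; _≢_; refl; trans; cong; subst; subst₂)
open import Function.Bundles using (mk⇔)
open import Function.Properties.Equivalence using () renaming (trans to ⇔-trans)
open import Data.Sum.Function.Propositional using (_⊎-⇔_)
open import Data.Nat.Tactic.RingSolver using (solve-∀)

residue-shift : ∀ n .{{_ : NonZero n}} {r d} → r < n → d < n → (r + d) % n ≡ r → d ≡ 0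
residue-shift n {r} {d} r<n d<n e with r + d <? n
... | yes r+d<n = +-cancelˡ-≡ r d 0 (trans (≡.sym (m<n⇒m%n≡m r+d<n)) (trans e (≡.sym (+-identityʳ r))))
... | no r+d≮n = ⊥-elim (<-irrefl d≡n d<n)
  where
    n≤r+d : n ≤ r + d
    n≤r+d = ≮⇒≥ r+d≮n
    r+d∸n<n : r + d ∸ n < n
    r+d∸n<n = +-cancelˡ-< n _ _ (subst (_< n + n) (≡.sym (m+[n∸m]≡n n≤r+d)) (+-mono-< r<n d<n))
    r+d∸n≡r : r + d ∸ n ≡ r
    r+d∸n≡r = trans (≡.sym (m<n⇒m%n≡m r+d∸n<n)) (trans (m≤n⇒[n∸m]%m≡n%m n≤r+d) e)
    d≡n : d ≡ n
    d≡n = +-cancelˡ-≡ r d n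
      (trans (≡.sym (m+[n∸m]≡n n≤r+d)) (trans (cong (n +_) r+d∸n≡r) (+-comm n r)))

%-shift : ∀ n .{{_ : NonZero n}} a d → d < n → (a + d) % n ≡ a % n → d ≡ 0
%-shift n a d d<n e = residue-shift n (m%n<n a n) d<n (begin
  (a % n + d) % n      ≡⟨ cong (λ x → (a % n + x) % n) (≡.sym (m<n⇒m%n≡m d<n)) ⟩
  (a % n + d % n) % n  ≡⟨ ≡.sym (%-distribˡ-+ a d n) ⟩
  (a + d) % n          ≡⟨ e ⟩
  a % n                ∎)
  where open ≡.≡-Reasoning

%-window-≤ : ∀ n .{{_ : NonZero n}} c {x y} → x ≤ y → y < n → (c + x) % n ≡ (c + y) % n → y ≤ x
%-window-≤ n c {x} {y} x≤y y<n e =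
  m∸n≡0⇒m≤n (%-shift n (c + x) (y ∸ x) (≤-<-trans (m∸n≤m y x) y<n) (trans (cong (_% n) c+y) (≡.sym e)))
  where c+y : c + x + (y ∸ x) ≡ c + y
        c+y = trans (+-assoc c x _) (cong (c +_) (m+[n∸m]≡n x≤y))

%-window-injective : ∀ n .{{_ : NonZero n}} c {x y} → x < n → y < n →
                     (c + x) % n ≡ (c + y) % n → x ≡ y
%-window-injective n c {x} {y} x<n y<n e with ≤-total x y
... | inj₁ x≤y = ≤-antisym x≤y (%-window-≤ n c x≤y y<n e)
... | inj₂ y≤x = ≤-antisym (%-window-≤ n c y≤x x<n (≡.sym e)) y≤x

-- Reading a blob cycle C cyclically: `at m` is the vertex at position m mod len C.
-- All later constructions describe cycles by such position functions ℕ → V.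
module Positions {V : Set} {G : Graph V} {s : ℕ} (C : BlobCycle G s) where
  instance
    len-nonZero : NonZero (len C)
    len-nonZero = >-nonZero (≤-trans (s≤s z≤n) (len≥3 C))

  at : ℕ → V
  at m = vert C (fromℕ< (m%n<n m (len C)))

  at-cong-% : ∀ {a b} → a % len C ≡ b % len C → at a ≡ at b
  at-cong-% {a} {b} e = cong (vert C) (fromℕ<-cong _ _ e (m%n<n a (len C)) (m%n<n b (len C)))

  at-% : ∀ m → at (m % len C) ≡ at m
  at-% m = at-cong-% (m%n%n≡m%n m (len C))

  at-< : ∀ {m} (m<len : m < len C) → at m ≡ vert C (fromℕ< m<len)
  at-< {m} m<len = cong (vert C) (fromℕ<-cong _ _ (m<n⇒m%n≡m m<len) (m%n<n m (len C)) m<len)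

  at-toℕ : ∀ i → at (toℕ i) ≡ vert C i
  at-toℕ i = trans (at-< (toℕ<n i)) (cong (vert C) (fromℕ<-toℕ i (toℕ<n i)))

  at-+len : ∀ m → at (m + len C) ≡ at m
  at-+len m = at-cong-% ([m+n]%n≡m%n m (len C))

  at-len+ : ∀ m → at (len C + m) ≡ at m
  at-len+ m = trans (cong at (+-comm (len C) m)) (at-+len m)

  at-residue : ∀ {a b} → at a ≡ at b → a % len C ≡ b % len C
  at-residue {a} {b} e =
    trans (≡.sym (toℕ-fromℕ< (m%n<n a (len C)))) (trans (cong toℕ (distinct C e)) (toℕ-fromℕ< (m%n<n b (len C))))

  at-injective : ∀ {a b} → a < len C → b < len C → at a ≡ at b → a ≡ b
  at-injective a<len b<len e = trans (≡.sym (m<n⇒m%n≡m a<len)) (trans (at-residue e) (m<n⇒m%n≡m b<len))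

  at-window : ∀ c {x y} → x < len C → y < len C → at (c + x) ≡ at (c + y) → x ≡ y
  at-window c x<len y<len e = %-window-injective (len C) c x<len y<len (at-residue e)

  at-edge-< : ∀ {r} → r < len C → Adj G (at r) (at (suc r))
  at-edge-< {r} r<len with suc r <? len C
  ... | yes r+1<len = subst₂ (Adj G) (≡.sym (at-< r<len)) (≡.sym (at-< r+1<len))
        (cycEdge C _ _ (inj₁ (trans (cong suc (toℕ-fromℕ< r<len)) (≡.sym (toℕ-fromℕ< r+1<len)))))
  ... | no r+1≮len = subst₂ (Adj G) (≡.sym (at-< r<len)) (trans (≡.sym (at-< 0<len)) at0≡at[r+1])
        (cycEdge C _ _ (inj₂ (trans (cong suc (toℕ-fromℕ< r<len)) r+1≡len , toℕ-fromℕ< 0<len)))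
    where
      r+1≡len : suc r ≡ len C
      r+1≡len = ≤-antisym r<len (≮⇒≥ r+1≮len)
      0<len : 0 < len C
      0<len = ≤-trans (s≤s z≤n) r<len
      at0≡at[r+1] : at 0 ≡ at (suc r)
      at0≡at[r+1] = trans (≡.sym (at-+len 0)) (cong at (≡.sym r+1≡len))

  at-edge : ∀ m → Adj G (at m) (at (suc m))
  at-edge m = subst₂ (Adj G) (at-% m) (at-cong-% residue) (at-edge-< (m%n<n m (len C)))
    where
      residue : suc (m % len C) % len C ≡ suc m % len C
      residue = trans (≡.sym ([m+kn]%n≡m%n (suc (m % len C)) (m / len C) (len C)))
                      (cong (λ x → suc x % len C) (≡.sym (m≡m%n+[m/n]*n m (len C))))

  at-clique : ∀ {a b} → a < s → b < s → a ≢ b → Adj G (at a) (at b)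
  at-clique {a} {b} a<s b<s a≢b = subst₂ (Adj G) (≡.sym (at-< a<len)) (≡.sym (at-< b<len))
      (blobClique C _ _ (subst (_< s) (≡.sym (toℕ-fromℕ< a<len)) a<s) (subst (_< s) (≡.sym (toℕ-fromℕ< b<len)) b<s)
         λ e → a≢b (trans (≡.sym (toℕ-fromℕ< a<len)) (trans (cong toℕ e) (toℕ-fromℕ< b<len))))
    where
      a<len = <-≤-trans a<s (s≤len C)
      b<len = <-≤-trans b<s (s≤len C)

  ∈V⇒at : ∀ {v} → v ∈V C → ∃[ a ] (a < len C × at a ≡ v)
  ∈V⇒at (i , e) = toℕ i , toℕ<n i , trans (at-toℕ i) e

  at⇒∈V : ∀ {v a} → a < len C → at a ≡ v → v ∈V C
  at⇒∈V a<len e = fromℕ< a<len , trans (≡.sym (at-< a<len)) e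

  at-∈V : ∀ m → at m ∈V C
  at-∈V m = at⇒∈V (m%n<n m (len C)) (at-% m)

  ∈Blob⇒at : ∀ {v} → v ∈Blob C → ∃[ a ] (a < s × at a ≡ v)
  ∈Blob⇒at (i , i<s , e) = toℕ i , i<s , trans (at-toℕ i) e

  at⇒∈Blob : ∀ {v a} → a < s → at a ≡ v → v ∈Blob C
  at⇒∈Blob {a = a} a<s e =
    fromℕ< a<len , subst (_< s) (≡.sym (toℕ-fromℕ< a<len)) a<s , trans (≡.sym (at-< a<len)) e
    where a<len = <-≤-trans a<s (s≤len C)

module _ {V : Set} {G : Graph V} where

  record IsBlobCycle (N s' : ℕ) (F : ℕ → V) : Set where
    field
      3≤N       : 3 ≤ N
      s'≤N      : s' ≤ N
      injective : ∀ a b → a < N → b < N → F a ≡ F b → a ≡ b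
      edge      : ∀ a → suc a < N → Adj G (F a) (F (suc a))
      closing   : ∀ a → suc a ≡ N → Adj G (F a) (F 0)
      clique    : ∀ a b → a < s' → b < s' → a ≢ b → Adj G (F a) (F b)

  toBlobCycle : ∀ {N s' F} → IsBlobCycle N s' F → BlobCycle G s'
  toBlobCycle {N} {s'} {F} isC = record
    { len        = N
    ; len≥3      = 3≤N
    ; s≤len      = s'≤N
    ; vert       = λ i → F (toℕ i)
    ; distinct   = λ {i} {j} e → toℕ-injective (injective _ _ (toℕ<n i) (toℕ<n j) e)
    ; cycEdge    = cycEdge'
    ; blobClique = λ i j i<s' j<s' i≢j → clique _ _ i<s' j<s' (λ e → i≢j (toℕ-injective e))
    }
    where
      open IsBlobCycle isC
      cycEdge' : ∀ (i j : Fin N) → CycNext i j → Adj G (F (toℕ i)) (F (toℕ j))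
      cycEdge' i j (inj₁ e) =
        subst (λ x → Adj G (F (toℕ i)) (F x)) e (edge _ (subst (_< N) (≡.sym e) (toℕ<n j)))
      cycEdge' i j (inj₂ (e , j≡0)) = subst (λ x → Adj G (F (toℕ i)) (F x)) (≡.sym j≡0) (closing _ e)

  at-toBlobCycle : ∀ {N s' F} (isC : IsBlobCycle N s' F) {a} → a < N →
                   Positions.at (toBlobCycle isC) a ≡ F a
  at-toBlobCycle {F = F} isC a<N = trans (Positions.at-< (toBlobCycle isC) a<N) (cong F (toℕ-fromℕ< a<N))

  record Rearranges {s t : ℕ} (C : BlobCycle G s) (C' : BlobCycle G t) : Set where
    field
      vertices⊆ : ∀ v → v ∈V C' → v ∈V C
      vertices⊇ : ∀ v → v ∈V C → v ∈V C'
      blob⊆     : ∀ v → v ∈Blob C' → v ∈Blob C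

  rearranges-vertices : ∀ {s t} {C : BlobCycle G s} {C' : BlobCycle G t} →
                        Rearranges C C' → ∀ v → (v ∈V C') ⇔ (v ∈V C)
  rearranges-vertices CC' v = mk⇔ (Rearranges.vertices⊆ CC' v) (Rearranges.vertices⊇ CC' v)

  rearranges-refl : ∀ {s} (C : BlobCycle G s) → Rearranges C C
  rearranges-refl C = record { vertices⊆ = λ _ x → x ; vertices⊇ = λ _ x → x ; blob⊆ = λ _ x → x }

  rearranges-trans : ∀ {s t u} {A : BlobCycle G s} {B : BlobCycle G t} {C : BlobCycle G u} →
                     Rearranges A B → Rearranges B C → Rearranges A C
  rearranges-trans AB BC = record
    { vertices⊆ = λ v x → vertices⊆ AB v (vertices⊆ BC v x)
    ; vertices⊇ = λ v x → vertices⊇ BC v (vertices⊇ AB v x)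
    ; blob⊆     = λ v x → blob⊆ AB v (blob⊆ BC v x) }
    where open Rearranges

swap : ℕ → ℕ → ℕ → ℕ
swap a c x with x ≟ a
... | yes _ = c
... | no _ with x ≟ c
...   | yes _ = a
...   | no _ = x

data SwapView (a c x y : ℕ) : Set where
  at-a  : x ≡ a → y ≡ c → SwapView a c x y
  at-c  : x ≢ a → x ≡ c → y ≡ a → SwapView a c x y
  other : x ≢ a → x ≢ c → y ≡ x → SwapView a c x y

swapView : ∀ a c x → SwapView a c x (swap a c x)
swapView a c x with x ≟ a
... | yes x≡a = at-a x≡a refl
... | no x≢a with x ≟ c
...   | yes x≡c = at-c x≢a x≡c refl
...   | no x≢c = other x≢a x≢c refl

swap-a : ∀ a c → swap a c a ≡ c
swap-a a c with swapView a c a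
... | at-a _ e = e
... | at-c a≢a _ _ = ⊥-elim (a≢a refl)
... | other a≢a _ _ = ⊥-elim (a≢a refl)

swap-c : ∀ a c → swap a c c ≡ a
swap-c a c with swapView a c c
... | at-a c≡a e = trans e c≡a
... | at-c _ _ e = e
... | other _ c≢c _ = ⊥-elim (c≢c refl)

swap-fixes : ∀ {a c x} → x ≢ a → x ≢ c → swap a c x ≡ x
swap-fixes {a} {c} {x} x≢a x≢c with swapView a c x
... | at-a x≡a _ = ⊥-elim (x≢a x≡a)
... | at-c _ x≡c _ = ⊥-elim (x≢c x≡c)
... | other _ _ e = e

swap-involutive : ∀ a c x → swap a c (swap a c x) ≡ x
swap-involutive a c x with swapView a c x
... | at-a x≡a y≡c = trans (cong (swap a c) y≡c) (trans (swap-c a c) (≡.sym x≡a))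
... | at-c _ x≡c y≡a = trans (cong (swap a c) y≡a) (trans (swap-a a c) (≡.sym x≡c))
... | other x≢a x≢c y≡x = trans (cong (swap a c) y≡x) (swap-fixes x≢a x≢c)

swap-injective : ∀ a c {x y} → swap a c x ≡ swap a c y → x ≡ y
swap-injective a c {x} {y} e =
  trans (≡.sym (swap-involutive a c x)) (trans (cong (swap a c) e) (swap-involutive a c y))

swap-preserves : ∀ (P : ℕ → Set) {a c x} → P a → P c → P x → P (swap a c x)
swap-preserves P {a} {c} {x} pa pc px with swapView a c x
... | at-a _ e = subst P (≡.sym e) pc
... | at-c _ _ e = subst P (≡.sym e) pa
... | other _ _ e = subst P (≡.sym e) px

-- Since the blob is a clique, the
-- interior positions can be permuted without destroying the cycle.
Interior : ℕ → ℕ → Set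
Interior s x = 0 < x × suc x < s

module SwapInterior {V : Set} {G : Graph V} {s : ℕ} (C : BlobCycle G s)
                    {a c : ℕ} (a-int : Interior s a) (c-int : Interior s c) where
  open Positions C

  private
    a<s : a < s
    a<s = <-trans (n<1+n a) (proj₂ a-int)
    c<s : c < s
    c<s = <-trans (n<1+n c) (proj₂ c-int)
    blob⇒len : ∀ {x} → x < s → x < len C
    blob⇒len x<s = <-≤-trans x<s (s≤len C)
    swap-<s : ∀ {x} → x < s → swap a c x < s
    swap-<s = swap-preserves (_< s) a<s c<s
    swap-<len : ∀ {x} → x < len C → swap a c x < len C
    swap-<len = swap-preserves (_< len C) (blob⇒len a<s) (blob⇒len c<s)

    swap-outside : ∀ {x} → s ≤ suc x → swap a c x ≡ x
    swap-outside s≤x+1 = swap-fixes (λ { refl → <⇒≱ (proj₂ a-int) s≤x+1 })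
                                    (λ { refl → <⇒≱ (proj₂ c-int) s≤x+1 })
    swap-0 : swap a c 0 ≡ 0
    swap-0 = swap-fixes (<⇒≢ (proj₁ a-int)) (<⇒≢ (proj₁ c-int))

  swapped-isBlobCycle : IsBlobCycle {G = G} (len C) s (λ x → at (swap a c x))
  swapped-isBlobCycle = record
    { 3≤N = len≥3 C
    ; s'≤N = s≤len C
    ; injective = λ x y x<len y<len e →
        swap-injective a c (at-injective (swap-<len x<len) (swap-<len y<len) e)
    ; edge = edge
    ; closing = closing
    ; clique = λ x y x<s y<s x≢y → at-clique (swap-<s x<s) (swap-<s y<s) (λ e → x≢y (swap-injective a c e))
    }
    where
      edge : ∀ x → suc x < len C → Adj G (at (swap a c x)) (at (swap a c (suc x)))
      edge x _ with suc x <? s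
      ... | yes x+1<s = at-clique (swap-<s (<-trans (n<1+n x) x+1<s)) (swap-<s x+1<s)
                          (λ e → 1+n≢n (≡.sym (swap-injective a c e)))
      ... | no x+1≮s = subst₂ (Adj G) (cong at (≡.sym (swap-outside s≤x+1)))
                          (cong at (≡.sym (swap-outside (≤-trans s≤x+1 (n≤1+n _))))) (at-edge x)
        where s≤x+1 = ≮⇒≥ x+1≮s
      closing : ∀ x → suc x ≡ len C → Adj G (at (swap a c x)) (at (swap a c 0))
      closing x x+1≡len = subst₂ (Adj G) (cong at (≡.sym (swap-outside s≤x+1)))
          (trans (cong at x+1≡len) (trans (at-+len 0) (cong at (≡.sym swap-0)))) (at-edge x)
        where s≤x+1 = subst (s ≤_) (≡.sym x+1≡len) (s≤len C)

  swapped : BlobCycle G s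
  swapped = toBlobCycle swapped-isBlobCycle

  at-swapped : ∀ {x} → x < len C → Positions.at swapped x ≡ at (swap a c x)
  at-swapped = at-toBlobCycle swapped-isBlobCycle

  swapped-rearranges : Rearranges C swapped
  swapped-rearranges = record
    { vertices⊆ = λ v v∈ → let (x , x<len , e) = Positions.∈V⇒at swapped v∈ in
        at⇒∈V (swap-<len x<len) (trans (≡.sym (at-swapped x<len)) e)
    ; vertices⊇ = λ v v∈ → let (x , x<len , e) = ∈V⇒at v∈ in
        Positions.at⇒∈V swapped (swap-<len x<len)
          (trans (at-swapped (swap-<len x<len)) (trans (cong at (swap-involutive a c x)) e))
    ; blob⊆ = λ v v∈ → let (x , x<s , e) = Positions.∈Blob⇒at swapped v∈ in
        at⇒∈Blob (swap-<s x<s) (trans (≡.sym (at-swapped (blob⇒len x<s))) e)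
    }

moveInterior : ∀ {V} {G : Graph V} {s} (C : BlobCycle G s) {a b c d} →
               Interior s a → Interior s b → Interior s c → Interior s d → a ≢ b → c ≢ d →
               Σ (BlobCycle G s) λ C' → Rearranges C C'
                 × (Positions.at C' c ≡ Positions.at C a) × (Positions.at C' d ≡ Positions.at C b)
moveInterior {s = s} C {a} {b} {c} {d} a-int b-int c-int d-int a≢b c≢d =
  C₂ , rearranges-trans (S₁.swapped-rearranges) (S₂.swapped-rearranges) , c↦a , d↦b
  where
    open Positions C
    module S₁ = SwapInterior C a-int c-int
    b' = swap a c b
    b'-int : Interior s b'
    b'-int = swap-preserves (Interior s) a-int c-int b-int
    module S₂ = SwapInterior S₁.swapped b'-int d-int
    C₂ = S₂.swapped
    interior<len : ∀ {x} → Interior s x → x < len C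
    interior<len x-int = <-≤-trans (<-trans (n<1+n _) (proj₂ x-int)) (s≤len C)
    c≢b' : c ≢ b'
    c≢b' e = a≢b (trans (≡.sym (swap-c a c)) (trans (cong (swap a c) e) (swap-involutive a c b)))
    c↦a : Positions.at C₂ c ≡ at a
    c↦a = begin
      Positions.at C₂ c                 ≡⟨ S₂.at-swapped (interior<len c-int) ⟩
      Positions.at S₁.swapped (swap b' d c) ≡⟨ cong (Positions.at S₁.swapped) (swap-fixes c≢b' c≢d) ⟩
      Positions.at S₁.swapped c         ≡⟨ S₁.at-swapped (interior<len c-int) ⟩
      at (swap a c c)                   ≡⟨ cong at (swap-c a c) ⟩
      at a                              ∎
      where open ≡.≡-Reasoning
    d↦b : Positions.at C₂ d ≡ at b
    d↦b = begin
      Positions.at C₂ d                 ≡⟨ S₂.at-swapped (interior<len d-int) ⟩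
      Positions.at S₁.swapped (swap b' d d) ≡⟨ cong (Positions.at S₁.swapped) (swap-c b' d) ⟩
      Positions.at S₁.swapped b'        ≡⟨ S₁.at-swapped (interior<len b'-int) ⟩
      at (swap a c b')                  ≡⟨ cong at (swap-involutive a c b) ⟩
      at b                              ∎
      where open ≡.≡-Reasoning

-- If C[p] ~ D[j+1] and
-- D[j] ~ C[p+1], then
--     C[0], …, C[p], D[j+1], D[j+2], …, D[j+len D], C[p+1], …, C[len C - 1]
-- (D read cyclically, ending at D[j+len D] = D[j]) is a cycle on the union of
-- the vertex sets.  Its first s' ≤ p+1 positions are those of C, so any
-- s' ≤ s of them still form a blob.

data Region (p k x : ℕ) : Set where
  before : x ≤ p → Region p k x
  inside : p < x → x ≤ p + k → Region p k x
  after  : p + k < x → Region p k x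

region : ∀ p k x → Region p k x
region p k x with x ≤? p
... | yes x≤p = before x≤p
... | no x≰p with x ≤? p + k
...   | yes x≤p+k = inside (≰⇒> x≰p) x≤p+k
...   | no x≰p+k = after (≰⇒> x≰p+k)

module Splice {V : Set} {G : Graph V} {s t : ℕ} (C : BlobCycle G s) (D : BlobCycle G t)
  (disjoint : VDisjoint C D) {p s' j : ℕ} (p<len : p < len C) (s'≤s : s' ≤ s) (s'≤p+1 : s' ≤ suc p)
  (j<len : j < len D)
  (enter : Adj G (Positions.at C p) (Positions.at D (suc j)))
  (leave : Adj G (Positions.at D j) (Positions.at C (suc p))) where

  module C = Positions C
  module D = Positions D
  n = len C
  k = len D
  N = n + k

  private
    1≤k : 1 ≤ k
    1≤k = ≤-trans (s≤s z≤n) (len≥3 D)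
    k≤x : ∀ {x} → p + k < x → k ≤ x
    k≤x p+k<x = ≤-trans (m≤n+m k p) (<⇒≤ p+k<x)
    offset<k : ∀ {x} → p < x → x ≤ p + k → x ∸ suc p < k
    offset<k {x} p<x x≤p+k = subst (x ∸ suc p <_) (m+n∸m≡n (suc p) k) (∸-monoˡ-< (s≤s x≤p+k) p<x)
    after<n : ∀ {x} → p + k < x → x < N → x ∸ k < n
    after<n {x} p+k<x x<N = subst (x ∸ k <_) (m+n∸n≡m n k) (∸-monoˡ-< x<N (k≤x p+k<x))
    p<after : ∀ {x} → p + k < x → p < x ∸ k
    p<after p+k<x = m+n≤o⇒m≤o∸n (suc p) p+k<x
    p<p+k : p < p + k
    p<p+k = subst (_≤ p + k) (+-comm p 1) (+-monoʳ-≤ p 1≤k)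
    suc-∸ : ∀ {x m} → m ≤ x → suc x ∸ m ≡ suc (x ∸ m)
    suc-∸ m≤x = +-∸-assoc 1 m≤x
    last-offset : suc j + (p + k ∸ suc p) ≡ j + k
    last-offset = begin
      suc j + (p + k ∸ suc p)    ≡⟨ cong (λ m → suc j + (p + k ∸ m)) (+-comm 1 p) ⟩
      suc j + (p + k ∸ (p + 1))  ≡⟨ cong (suc j +_) ([m+n]∸[m+o]≡n∸o p k 1) ⟩
      suc j + (k ∸ 1)            ≡⟨ ≡.sym (+-suc j (k ∸ 1)) ⟩
      j + suc (k ∸ 1)            ≡⟨ cong (j +_) (m+[n∸m]≡n 1≤k) ⟩
      j + k                      ∎
      where open ≡.≡-Reasoning

  F : ℕ → V
  F x with region p k x
  ... | before _ = C.at x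
  ... | inside _ _ = D.at (suc j + (x ∸ suc p))
  ... | after _ = C.at (x ∸ k)

  F-before : ∀ {x} → x ≤ p → F x ≡ C.at x
  F-before {x} x≤p with region p k x
  ... | before _ = refl
  ... | inside p<x _ = ⊥-elim (<⇒≱ p<x x≤p)
  ... | after p+k<x = ⊥-elim (<⇒≱ p+k<x (≤-trans x≤p (m≤m+n p k)))

  F-inside : ∀ {x} → p < x → x ≤ p + k → F x ≡ D.at (suc j + (x ∸ suc p))
  F-inside {x} p<x x≤p+k with region p k x
  ... | before x≤p = ⊥-elim (<⇒≱ p<x x≤p)
  ... | inside _ _ = refl
  ... | after p+k<x = ⊥-elim (<⇒≱ p+k<x x≤p+k)

  F-after : ∀ {x} → p + k < x → F x ≡ C.at (x ∸ k)
  F-after {x} p+k<x with region p k x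
  ... | before x≤p = ⊥-elim (<⇒≱ p+k<x (≤-trans x≤p (m≤m+n p k)))
  ... | inside _ x≤p+k = ⊥-elim (<⇒≱ p+k<x x≤p+k)
  ... | after _ = refl

  F-first : F (suc p) ≡ D.at (suc j)
  F-first = trans (F-inside (n<1+n p) p<p+k)
                  (cong D.at (trans (cong (suc j +_) (n∸n≡0 p)) (+-identityʳ (suc j))))

  F-last : F (p + k) ≡ D.at j
  F-last = trans (F-inside (<-≤-trans (n<1+n p) p<p+k) ≤-refl)
                 (trans (cong D.at last-offset) (D.at-+len j))

  private
    C≢D : ∀ {a b} → C.at a ≡ D.at b → ⊥
    C≢D {a} {b} e = disjoint (C.at a) (C.at-∈V a) (subst (_∈V D) (≡.sym e) (D.at-∈V b))

    before≢after : ∀ {a b} → a ≤ p → p + k < b → b < N → C.at a ≢ C.at (b ∸ k)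
    before≢after a≤p p+k<b b<N e =
      <⇒≱ (p<after p+k<b) (subst (_≤ p) (C.at-injective (≤-<-trans a≤p p<len) (after<n p+k<b b<N) e) a≤p)

  F-injective : ∀ a b → a < N → b < N → F a ≡ F b → a ≡ b
  F-injective a b a<N b<N e = byRegion (region p k a) (region p k b)
    where
    same : ∀ {u w} → F a ≡ u → F b ≡ w → u ≡ w
    same Fa≡u Fb≡w = trans (≡.sym Fa≡u) (trans e Fb≡w)
    byRegion : Region p k a → Region p k b → a ≡ b
    byRegion (before a≤p) (before b≤p) =
      C.at-injective (≤-<-trans a≤p p<len) (≤-<-trans b≤p p<len) (same (F-before a≤p) (F-before b≤p))
    byRegion (before a≤p) (inside p<b b≤) = ⊥-elim (C≢D (same (F-before a≤p) (F-inside p<b b≤)))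
    byRegion (inside p<a a≤) (before b≤p) = ⊥-elim (C≢D (≡.sym (same (F-inside p<a a≤) (F-before b≤p))))
    byRegion (before a≤p) (after p+k<b) = ⊥-elim (before≢after a≤p p+k<b b<N (same (F-before a≤p) (F-after p+k<b)))
    byRegion (after p+k<a) (before b≤p) =
      ⊥-elim (before≢after b≤p p+k<a a<N (≡.sym (same (F-after p+k<a) (F-before b≤p))))
    byRegion (inside p<a a≤) (inside p<b b≤) = ∸-cancelʳ-≡ p<a p<b
      (D.at-window (suc j) (offset<k p<a a≤) (offset<k p<b b≤) (same (F-inside p<a a≤) (F-inside p<b b≤)))
    byRegion (inside p<a a≤) (after p+k<b) = ⊥-elim (C≢D (≡.sym (same (F-inside p<a a≤) (F-after p+k<b))))
    byRegion (after p+k<a) (inside p<b b≤) = ⊥-elim (C≢D (same (F-after p+k<a) (F-inside p<b b≤)))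
    byRegion (after p+k<a) (after p+k<b) = ∸-cancelʳ-≡ (k≤x p+k<a) (k≤x p+k<b)
      (C.at-injective (after<n p+k<a a<N) (after<n p+k<b b<N) (same (F-after p+k<a) (F-after p+k<b)))

  F-edge : ∀ x → suc x < N → Adj G (F x) (F (suc x))
  F-edge x _ with <-cmp x p
  ... | tri< x<p _ _ = subst₂ (Adj G) (≡.sym (F-before (<⇒≤ x<p))) (≡.sym (F-before x<p)) (C.at-edge x)
  ... | tri≈ _ refl _ = subst₂ (Adj G) (≡.sym (F-before ≤-refl)) (≡.sym F-first) enter
  ... | tri> _ _ p<x with <-cmp x (p + k)
  ...   | tri< x<p+k _ _ = subst₂ (Adj G) (≡.sym (F-inside p<x (<⇒≤ x<p+k)))
            (≡.sym (trans (F-inside (<-trans p<x (n<1+n x)) x<p+k)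
                          (cong D.at (trans (cong (suc j +_) (suc-∸ p<x)) (+-suc (suc j) _)))))
            (D.at-edge (suc j + (x ∸ suc p)))
  ...   | tri≈ _ refl _ = subst₂ (Adj G) (≡.sym F-last)
            (≡.sym (trans (F-after (n<1+n (p + k)))
                          (cong C.at (trans (suc-∸ (m≤n+m k p)) (cong suc (m+n∸n≡m p k)))))) leave
  ...   | tri> _ _ p+k<x = subst₂ (Adj G) (≡.sym (F-after p+k<x))
            (≡.sym (trans (F-after (<-trans p+k<x (n<1+n x))) (cong C.at (suc-∸ (k≤x p+k<x))))) (C.at-edge (x ∸ k))

  F-closing : ∀ x → suc x ≡ N → Adj G (F x) (F 0)
  F-closing x x+1≡N with <-cmp x (p + k)
  ... | tri< x<p+k _ _ = ⊥-elim (<-irrefl x+1≡N (≤-<-trans x<p+k (+-monoˡ-< k p<len)))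
  ... | tri≈ _ refl _ = subst₂ (Adj G) (≡.sym F-last)
          (trans (cong C.at p+1≡n) (trans (C.at-+len 0) (≡.sym (F-before z≤n)))) leave
    where p+1≡n : suc p ≡ n
          p+1≡n = +-cancelʳ-≡ k (suc p) n x+1≡N
  ... | tri> _ _ p+k<x = subst₂ (Adj G) (≡.sym (F-after p+k<x))
          (trans (cong C.at x∸k+1≡n) (trans (C.at-+len 0) (≡.sym (F-before z≤n)))) (C.at-edge (x ∸ k))
    where x∸k+1≡n : suc (x ∸ k) ≡ n
          x∸k+1≡n = trans (≡.sym (suc-∸ (k≤x p+k<x))) (trans (cong (_∸ k) x+1≡N) (m+n∸n≡m n k))

  F-clique : ∀ a b → a < s' → b < s' → a ≢ b → Adj G (F a) (F b)
  F-clique a b a<s' b<s' a≢b = subst₂ (Adj G) (≡.sym (F-before (blob≤p a<s'))) (≡.sym (F-before (blob≤p b<s')))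
                                 (C.at-clique (<-≤-trans a<s' s'≤s) (<-≤-trans b<s' s'≤s) a≢b)
    where blob≤p : ∀ {x} → x < s' → x ≤ p
          blob≤p x<s' = ≤-pred (≤-trans x<s' s'≤p+1)

  spliced-isBlobCycle : IsBlobCycle {G = G} N s' F
  spliced-isBlobCycle = record
    { 3≤N = ≤-trans (len≥3 C) (m≤m+n n k)
    ; s'≤N = ≤-trans s'≤s (≤-trans (s≤len C) (m≤m+n n k))
    ; injective = F-injective ; edge = F-edge ; closing = F-closing ; clique = F-clique }

  spliced : BlobCycle G s'
  spliced = toBlobCycle spliced-isBlobCycle

  private
    at-spliced : ∀ {x} → x < N → Positions.at spliced x ≡ F x
    at-spliced = at-toBlobCycle spliced-isBlobCycle

    segment-covers : ∀ {y} → y < k → ∃[ u ] (u < k × D.at (suc j + u) ≡ D.at y)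
    segment-covers {y} y<k with suc j ≤? y
    ... | yes j<y = y ∸ suc j , ≤-<-trans (m∸n≤m y (suc j)) y<k , cong D.at (m+[n∸m]≡n j<y)
    ... | no j≮y = k + y ∸ suc j , u<k , trans (cong D.at (m+[n∸m]≡n j<k+y)) (D.at-len+ y)
      where
        j<k+y : suc j ≤ k + y
        j<k+y = ≤-trans j<len (m≤m+n k y)
        u<k : k + y ∸ suc j < k
        u<k = subst (k + y ∸ suc j <_) (m+n∸n≡m k (suc j)) (∸-monoˡ-< (+-monoʳ-< k (≰⇒> j≮y)) j<k+y)

  spliced⊆ : ∀ v → v ∈V spliced → v ∈V C ⊎ v ∈V D
  spliced⊆ v v∈ with Positions.∈V⇒at spliced v∈
  ... | x , x<N , e = fromRegion (region p k x)
    where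
      Fx≡v : F x ≡ v
      Fx≡v = trans (≡.sym (at-spliced x<N)) e
      fromRegion : Region p k x → v ∈V C ⊎ v ∈V D
      fromRegion (before x≤p) = inj₁ (subst (_∈V C) (trans (≡.sym (F-before x≤p)) Fx≡v) (C.at-∈V _))
      fromRegion (inside p<x x≤) = inj₂ (subst (_∈V D) (trans (≡.sym (F-inside p<x x≤)) Fx≡v) (D.at-∈V _))
      fromRegion (after p+k<x) = inj₁ (subst (_∈V C) (trans (≡.sym (F-after p+k<x)) Fx≡v) (C.at-∈V _))

  C⊆spliced : ∀ v → v ∈V C → v ∈V spliced
  C⊆spliced v v∈ with C.∈V⇒at v∈
  ... | x , x<n , e with x ≤? p
  ...   | yes x≤p = Positions.at⇒∈V spliced x<N (trans (at-spliced x<N) (trans (F-before x≤p) e))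
    where x<N = <-≤-trans x<n (m≤m+n n k)
  ...   | no x≰p = Positions.at⇒∈V spliced x+k<N (begin
            Positions.at spliced (x + k)  ≡⟨ at-spliced x+k<N ⟩
            F (x + k)                     ≡⟨ F-after (+-monoˡ-< k (≰⇒> x≰p)) ⟩
            C.at (x + k ∸ k)              ≡⟨ cong C.at (m+n∸n≡m x k) ⟩
            C.at x                        ≡⟨ e ⟩
            v                             ∎)
    where x+k<N = +-monoˡ-< k x<n
          open ≡.≡-Reasoning

  D⊆spliced : ∀ v → v ∈V D → v ∈V spliced
  D⊆spliced v v∈ with D.∈V⇒at v∈
  ... | y , y<k , e with segment-covers y<k
  ...   | u , u<k , hit = Positions.at⇒∈V spliced x<N (begin
            Positions.at spliced x      ≡⟨ at-spliced x<N ⟩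
            F x                         ≡⟨ F-inside p<x x≤p+k ⟩
            D.at (suc j + (x ∸ suc p))  ≡⟨ cong (λ w → D.at (suc j + w)) (m+n∸m≡n (suc p) u) ⟩
            D.at (suc j + u)            ≡⟨ hit ⟩
            D.at y                      ≡⟨ e ⟩
            v                           ∎)
    where
      open ≡.≡-Reasoning
      x = suc p + u
      p<x : p < x
      p<x = s≤s (m≤m+n p u)
      x≤p+k : x ≤ p + k
      x≤p+k = subst (_≤ p + k) (+-suc p u) (+-monoʳ-≤ p u<k)
      x<N : x < N
      x<N = ≤-<-trans x≤p+k (+-monoˡ-< k p<len)

  spliced-vertices : ∀ v → v ∈V spliced ⇔ (v ∈V C ⊎ v ∈V D)
  spliced-vertices v = mk⇔ (spliced⊆ v) [ C⊆spliced v , D⊆spliced v ]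

  spliced-blob : ∀ v → v ∈Blob spliced → v ∈Blob C
  spliced-blob v v∈ with Positions.∈Blob⇒at spliced v∈
  ... | x , x<s' , e = C.at⇒∈Blob (<-≤-trans x<s' s'≤s)
          (trans (≡.sym (F-before (≤-pred (≤-trans x<s' s'≤p+1)))) (trans (≡.sym (at-spliced x<N)) e))
    where x<N = <-≤-trans x<s' (IsBlobCycle.s'≤N spliced-isBlobCycle)

-- spread r = ⌊3r/2⌋: consecutive values differ by 1 or 2, values two apart
-- by at least 3.  Shifting spread r by a colour a ∈ {0, 1, 2} therefore lets
-- two colours collide only at equal or consecutive r.
spread : ℕ → ℕ
spread zero = zero
spread (suc zero) = 1
spread (suc (suc r)) = 3 + spread r

spread-step : ∀ r → spread r < spread (suc r)
spread-step zero = s≤s z≤n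
spread-step (suc zero) = s≤s (s≤s z≤n)
spread-step (suc (suc r)) = s≤s (s≤s (s≤s (spread-step r)))

spread-mono : ∀ {r r'} → r ≤ r' → spread r ≤ spread r'
spread-mono {r} {r'} r≤r' = subst (λ x → spread r ≤ spread x) (m+[n∸m]≡n r≤r') (go r (r' ∸ r))
  where
    go : ∀ r d → spread r ≤ spread (r + d)
    go r zero = ≤-reflexive (cong spread (≡.sym (+-identityʳ r)))
    go r (suc d) = ≤-trans (go r d) (≤-trans (<⇒≤ (spread-step (r + d))) (≤-reflexive (cong spread (≡.sym (+-suc r d)))))

spread-injective : ∀ {r r'} → spread r ≡ spread r' → r ≡ r'
spread-injective {r} {r'} e with <-cmp r r'
... | tri< r<r' _ _ = ⊥-elim (<-irrefl e (<-≤-trans (spread-step r) (spread-mono r<r')))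
... | tri≈ _ r≡r' _ = r≡r'
... | tri> _ _ r'<r = ⊥-elim (<-irrefl (≡.sym e) (<-≤-trans (spread-step r') (spread-mono r'<r)))

spread-bound : ∀ r → 2 * spread r ≤ 3 * r
spread-bound zero = z≤n
spread-bound (suc zero) = s≤s (s≤s z≤n)
spread-bound (suc (suc r)) = subst₂ _≤_ (≡.sym (double ((spread r)))) (≡.sym (triple r)) (+-monoʳ-≤ 6 (spread-bound r))
  where
    double : ∀ x → 2 * (3 + x) ≡ 6 + 2 * x
    double = solve-∀
    triple : ∀ x → 3 * suc (suc x) ≡ 6 + 3 * x
    triple = solve-∀

spread-apart : ∀ {r r' a a'} → suc (suc r) ≤ r' → a ≤ 2 → spread r + a < spread r' + a'
spread-apart {r} {r'} {a} {a'} r+2≤r' a≤2 = begin-strict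
  spread r + a     ≤⟨ +-monoʳ-≤ (spread r) a≤2 ⟩
  spread r + 2     <⟨ ≤-reflexive (trans (≡.sym (+-suc (spread r) 2)) (+-comm (spread r) 3)) ⟩
  3 + spread r     ≤⟨ spread-mono r+2≤r' ⟩
  spread r'        ≤⟨ m≤m+n (spread r') a' ⟩
  spread r' + a'   ∎
  where open ≤-Reasoning

spread-collision : ∀ {r r' a a'} → a ≤ 2 → a' ≤ 2 → a ≢ a' →
                   spread r + a ≡ spread r' + a' → r' ≡ suc r ⊎ r ≡ suc r'
spread-collision {r} {r'} {a} {a'} a≤2 a'≤2 a≢a' e with <-cmp r r'
... | tri≈ _ refl _ = ⊥-elim (a≢a' (+-cancelˡ-≡ (spread r) a a' e))
... | tri< r<r' _ _ with suc r ≟ r'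
...   | yes r+1≡r' = inj₁ (≡.sym r+1≡r')
...   | no r+1≢r' = ⊥-elim (<-irrefl e (spread-apart (≤∧≢⇒< r<r' r+1≢r') a≤2))
spread-collision {r} {r'} {a} {a'} a≤2 a'≤2 a≢a' e | tri> _ _ r'<r with suc r' ≟ r
...   | yes r'+1≡r = inj₂ (≡.sym r'+1≡r)
...   | no r'+1≢r = ⊥-elim (<-irrefl (≡.sym e) (spread-apart (≤∧≢⇒< r'<r r'+1≢r) a'≤2))

-- Slots for neighbours on an s-blob cycle C, s = σ + 1.  A position p seen
-- with colour a ∈ {0, 1, 2} gets the slot
--   (p - 1) + a          if p is an interior blob position (1 ≤ p ≤ σ - 1),
--   s + spread r + a     if p is the r-th vertex of the outer path
--                        σ, σ+1, …, n-1, 0 of C (so 0 ≤ r ≤ n - σ).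
-- Equal slots of different colours force two distinct interior positions or
-- an edge of the outer path; equal slots of one colour force equal positions.
module Slots {V : Set} {G : Graph V} {σ : ℕ} (C : BlobCycle G (suc σ)) where
  open Positions C
  s = suc σ
  n = len C
  z = n ∸ σ

  data OuterIndex (p r : ℕ) : Set where
    closing : p ≡ 0 → r ≡ z → OuterIndex p r
    onPath  : σ ≤ p → r ≡ p ∸ σ → OuterIndex p r

  data Kind (p : ℕ) : Set where
    inner : Interior s p → Kind p
    outer : ∀ r → OuterIndex p r → Kind p

  kind : ∀ p → Kind p
  kind zero = outer z (closing refl refl)
  kind (suc q) with suc (suc q) <? s
  ... | yes q+2<s = inner (s≤s z≤n , q+2<s)
  ... | no q+2≮s = outer (suc q ∸ σ) (onPath (≤-pred (≮⇒≥ q+2≮s)) refl)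

  slotOf : ℕ → (p : ℕ) → Kind p → ℕ
  slotOf a p (inner _) = (p ∸ 1) + a
  slotOf a p (outer r _) = s + spread r + a

  slot : ℕ → ℕ → ℕ
  slot a p = slotOf a p (kind p)

  slots : ℕ
  slots = s + spread z + 3

  OuterEdge : ℕ → ℕ → Set
  OuterEdge p p' = ∃[ q ] (σ ≤ q × q < n × at q ≡ at p × at (suc q) ≡ at p')

  private
    σ≤n : σ ≤ n
    σ≤n = ≤-trans (n≤1+n σ) (s≤len C)

    path-index<z : ∀ {p} → σ ≤ p → p < n → p ∸ σ < z
    path-index<z σ≤p p<n = ∸-monoˡ-< p<n σ≤p

    outer-index≤z : ∀ {p r} → p < n → OuterIndex p r → r ≤ z
    outer-index≤z _ (closing _ refl) = ≤-refl
    outer-index≤z p<n (onPath σ≤p refl) = <⇒≤ (path-index<z σ≤p p<n)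

    inner-slot<s : ∀ {p a} → Interior s p → a ≤ 2 → (p ∸ 1) + a < s
    inner-slot<s {suc q} (_ , q+2<s) a≤2 = ≤-<-trans (+-monoʳ-≤ q a≤2) (subst (_< s) (+-comm 2 q) q+2<s)

    inner≢outer : ∀ {p a r a'} → Interior s p → a ≤ 2 → (p ∸ 1) + a ≢ s + spread r + a'
    inner≢outer p-int a≤2 e =
      <⇒≱ (inner-slot<s p-int a≤2) (subst (s ≤_) (≡.sym e) (≤-trans (m≤m+n s _) (m≤m+n _ _)))

    outer-cancel : ∀ {r r' a a'} → s + spread r + a ≡ s + spread r' + a' → spread r + a ≡ spread r' + a'
    outer-cancel {r} {r'} {a} {a'} e =
      +-cancelˡ-≡ s _ _ (trans (≡.sym (+-assoc s (spread r) a)) (trans e (+-assoc s (spread r') a')))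

  slot-bound : ∀ {a p} → a ≤ 2 → p < n → slot a p < slots
  slot-bound {a} {p} a≤2 p<n with kind p
  ... | inner p-int = <-≤-trans (inner-slot<s p-int a≤2) (≤-trans (m≤m+n s _) (m≤m+n _ 3))
  ... | outer r r-idx = +-mono-≤-< (+-monoʳ-≤ s (spread-mono (outer-index≤z p<n r-idx))) (s≤s a≤2)

  outer-edge : ∀ {p p' r} → p < n → p' < n → OuterIndex p r → OuterIndex p' (suc r) → OuterEdge p p'
  outer-edge _ _ (closing _ r≡z) (closing _ r+1≡z) = ⊥-elim (1+n≢n (trans r+1≡z (≡.sym r≡z)))
  outer-edge _ p'<n (closing _ r≡z) (onPath σ≤p' r+1≡) =
    ⊥-elim (<-asym (path-index<z σ≤p' p'<n) (subst (z <_) (trans (≡.sym (cong suc r≡z)) r+1≡) (n<1+n z)))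
  outer-edge {p} p<n _ (onPath σ≤p r≡) (closing p'≡0 r+1≡z) =
    p , σ≤p , p<n , refl , trans (cong at p+1≡n) (trans (at-+len 0) (cong at (≡.sym p'≡0)))
    where p+1≡n : suc p ≡ n
          p+1≡n = ∸-cancelʳ-≡ (≤-trans σ≤p (n≤1+n p)) σ≤n
                    (trans (+-∸-assoc 1 σ≤p) (trans (cong suc (≡.sym r≡)) r+1≡z))
  outer-edge {p} p<n _ (onPath σ≤p r≡) (onPath σ≤p' r+1≡) = p , σ≤p , p<n , refl , cong at p+1≡p'
    where p+1≡p' : suc p ≡ _
          p+1≡p' = ∸-cancelʳ-≡ (≤-trans σ≤p (n≤1+n p)) σ≤p'
                     (trans (+-∸-assoc 1 σ≤p) (trans (cong suc (≡.sym r≡)) r+1≡))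

  outer-index-injective : ∀ {p p' r} → p < n → p' < n → OuterIndex p r → OuterIndex p' r → p ≡ p'
  outer-index-injective _ _ (closing p≡0 _) (closing p'≡0 _) = trans p≡0 (≡.sym p'≡0)
  outer-index-injective _ p'<n (closing _ r≡z) (onPath σ≤p' r≡) =
    ⊥-elim (<-irrefl (trans (≡.sym r≡) r≡z) (path-index<z σ≤p' p'<n))
  outer-index-injective p<n _ (onPath σ≤p r≡) (closing _ r≡z) =
    ⊥-elim (<-irrefl (trans (≡.sym r≡) r≡z) (path-index<z σ≤p p<n))
  outer-index-injective _ _ (onPath σ≤p r≡) (onPath σ≤p' r≡') = ∸-cancelʳ-≡ σ≤p σ≤p' (trans (≡.sym r≡) r≡')

  InnerPair : ℕ → ℕ → Set
  InnerPair p p' = Interior s p × Interior s p' × p ≢ p'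

  slot-collision : ∀ {a a' p p'} → a ≤ 2 → a' ≤ 2 → a ≢ a' → p < n → p' < n → slot a p ≡ slot a' p' →
                   OuterEdge p p' ⊎ OuterEdge p' p ⊎ InnerPair p p'
  slot-collision {a} {a'} {p} {p'} a≤2 a'≤2 a≢a' p<n p'<n e with kind p | kind p'
  ... | inner p-int | inner p'-int = inj₂ (inj₂ (p-int , p'-int , λ { refl → a≢a' (+-cancelˡ-≡ (p ∸ 1) a a' e) }))
  ... | inner p-int | outer r' _ = ⊥-elim (inner≢outer {r = r'} p-int a≤2 e)
  ... | outer r _ | inner p'-int = ⊥-elim (inner≢outer {r = r} p'-int a'≤2 (≡.sym e))
  ... | outer r r-idx | outer r' r'-idx with spread-collision a≤2 a'≤2 a≢a' (outer-cancel {r} {r'} e)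
  ...   | inj₁ r'≡r+1 = inj₁ (outer-edge p<n p'<n r-idx (subst (OuterIndex p') r'≡r+1 r'-idx))
  ...   | inj₂ r≡r'+1 = inj₂ (inj₁ (outer-edge p'<n p<n r'-idx (subst (OuterIndex p) r≡r'+1 r-idx)))

  slot-injective : ∀ {a p p'} → a ≤ 2 → p < n → p' < n → slot a p ≡ slot a p' → p ≡ p'
  slot-injective {a} {p} {p'} a≤2 p<n p'<n e with kind p | kind p'
  ... | inner p-int | inner p'-int = ∸-cancelʳ-≡ (proj₁ p-int) (proj₁ p'-int) (+-cancelʳ-≡ a _ _ e)
  ... | inner p-int | outer r' _ = ⊥-elim (inner≢outer {r = r'} p-int a≤2 e)
  ... | outer r _ | inner p'-int = ⊥-elim (inner≢outer {r = r} p'-int a≤2 (≡.sym e))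
  ... | outer r r-idx | outer r' r'-idx = outer-index-injective p<n p'<n r-idx
          (subst (OuterIndex p') (≡.sym (spread-injective (+-cancelʳ-≡ a _ _ (outer-cancel {r} {r'} e)))) r'-idx)

-- With blob size s = 20 + 6ℓ, a cycle of length
-- n = (19 + 6ℓ) + z ≤ 2h + 1 has s + spread z + 3 slots, fewer than the
-- 3(h - ℓ) incidences between the three interior vertices of C₂ and their
-- ≥ h - ℓ neighbours each (using 2 · spread z ≤ 3z, with y = spread z).
slot-count : ∀ ℓ z h y → 2 * y ≤ 3 * z → 19 + 6 * ℓ + z ≤ suc (2 * h) → 20 + 6 * ℓ + y + 3 < 3 * (h ∸ ℓ)
slot-count ℓ z h y 2y≤3z n≤2h+1 = *-cancelˡ-≤ 2 doubled
  where
    open ≤-Reasoning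
    ℓ≤h : ℓ ≤ h
    ℓ≤h with ℓ ≤? h
    ... | yes ℓ≤h = ℓ≤h
    ... | no ℓ≰h = ⊥-elim (<⇒≱ (begin-strict
      suc (2 * h)        <⟨ n<1+n _ ⟩
      2 + 2 * h          ≡⟨ ≡.sym (*-suc 2 h) ⟩
      2 * suc h          ≤⟨ *-monoʳ-≤ 2 (≰⇒> ℓ≰h) ⟩
      2 * ℓ              ≤⟨ *-monoˡ-≤ ℓ {2} {6} (s≤s (s≤s z≤n)) ⟩
      6 * ℓ              ≤⟨ ≤-trans (m≤n+m (6 * ℓ) 19) (m≤m+n _ z) ⟩
      19 + 6 * ℓ + z     ∎) n≤2h+1)
    H = h ∸ ℓ
    h≡ℓ+H : h ≡ ℓ + H
    h≡ℓ+H = ≡.sym (m+[n∸m]≡n ℓ≤h)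
    -- three times the length bound, with the ℓ-terms moved to one side
    tripled : 54 + 12 * ℓ + 3 * z ≤ 2 * (3 * H)
    tripled = +-cancelʳ-≤ (3 + 6 * ℓ) _ _ (subst₂ _≤_ (lhs ℓ z) (rhs ℓ H)
                (*-monoʳ-≤ 3 (subst (λ x → 19 + 6 * ℓ + z ≤ suc (2 * x)) h≡ℓ+H n≤2h+1)))
      where
        lhs : ∀ ℓ z → 3 * (19 + 6 * ℓ + z) ≡ (54 + 12 * ℓ + 3 * z) + (3 + 6 * ℓ)
        lhs = solve-∀
        rhs : ∀ ℓ H → 3 * suc (2 * (ℓ + H)) ≡ 2 * (3 * H) + (3 + 6 * ℓ)
        rhs = solve-∀
    doubled : 2 * suc (20 + 6 * ℓ + y + 3) ≤ 2 * (3 * H)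
    doubled = begin
      2 * suc (20 + 6 * ℓ + y + 3)  ≡⟨ expand ℓ y ⟩
      48 + 12 * ℓ + 2 * y           ≤⟨ +-monoʳ-≤ (48 + 12 * ℓ) 2y≤3z ⟩
      48 + 12 * ℓ + 3 * z           ≤⟨ +-monoˡ-≤ (3 * z) (+-monoˡ-≤ (12 * ℓ) (m≤n+m 48 6)) ⟩
      54 + 12 * ℓ + 3 * z           ≤⟨ tripled ⟩
      2 * (3 * H)                   ∎
      where
        expand : ∀ ℓ y → 2 * suc (20 + 6 * ℓ + y + 3) ≡ 48 + 12 * ℓ + 2 * y
        expand = solve-∀

pigeonhole-× : ∀ {a b N} (f : Fin a × Fin b → ℕ) → (∀ x → f x < N) → N < a * b →
               ∃₂ λ x y → x ≢ y × f x ≡ f y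
pigeonhole-× {a} {b} {N} f f<N N<ab with pigeonhole N<ab (λ i → fromℕ< (f<N (remQuot {a} b i)))
... | i , j , i<j , same = remQuot b i , remQuot b j , distinct-pairs ,
      trans (≡.sym (toℕ-fromℕ< (f<N (remQuot b i)))) (trans (cong toℕ same) (toℕ-fromℕ< (f<N (remQuot b j))))
  where
    distinct-pairs : remQuot b i ≢ remQuot b j
    distinct-pairs e = <-irrefl (cong toℕ (trans (≡.sym (combine-remQuot {a} b i))
                         (trans (cong (uncurry combine) e) (combine-remQuot {a} b j)))) i<j

module Absorption (ℓ : ℕ) {V : Set} (G : Graph V) (C₁ : BlobCycle G (20 + 6 * ℓ)) (C₂ : BlobCycle G 5)
  (disjoint : VDisjoint C₁ C₂)
  (many-nbrs : ∀ (i : Fin (len C₂)) → toℕ i < 5 → AtLeastNbrsOn G ((len C₁ / 2) ∸ ℓ) (vert C₂ i) C₁) where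

  σ = 19 + 6 * ℓ
  module P₁ = Positions C₁
  module P₂ = Positions C₂
  open Slots C₁

  Absorbed : Set
  Absorbed = ∃[ s′ ] Σ (BlobCycle G s′) λ C →
               (s ∸ 2 ≤ s′)
               × (∀ v → (v ∈V C) ⇔ (v ∈V C₁ ⊎ v ∈V C₂))
               × (∀ v → v ∈Blob C → v ∈Blob C₁)

  spliceAbsorbs : ∀ {s₀ t s' p} (C' : BlobCycle G s₀) (D : BlobCycle G t) →
                  Rearranges C₁ C' → Rearranges C₂ D → p < len C' → s' ≤ s₀ → s' ≤ suc p → s ∸ 2 ≤ s' →
                  Adj G (Positions.at C' p) (Positions.at D 3) → Adj G (Positions.at D 2) (Positions.at C' (suc p)) →
                  Absorbed
  spliceAbsorbs {s' = s'} C' D C₁C' C₂D p<len s'≤s₀ s'≤p+1 big enter leave =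
    s' , S.spliced , big ,
    (λ v → ⇔-trans (S.spliced-vertices v) (rearranges-vertices C₁C' v ⊎-⇔ rearranges-vertices C₂D v)) ,
    (λ v v∈ → Rearranges.blob⊆ C₁C' v (S.spliced-blob v v∈))
    where
      disjoint' : VDisjoint C' D
      disjoint' v v∈C' v∈D = disjoint v (Rearranges.vertices⊆ C₁C' v v∈C') (Rearranges.vertices⊆ C₂D v v∈D)
      module S = Splice C' D disjoint' p<len s'≤s₀ s'≤p+1 (≤-trans (s≤s (s≤s (s≤s z≤n))) (len≥3 D)) enter leave

  colour-pos : Fin 3 → ℕ
  colour-pos c = suc (toℕ c)

  x : Fin 3 → V
  x c = P₂.at (colour-pos c)

  colour-interior : ∀ c → Interior 5 (colour-pos c)
  colour-interior c = s≤s z≤n , s≤s (s≤s (toℕ<n c))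

  lineUp : ∀ c c' → toℕ c ≢ toℕ c' →
           Σ (BlobCycle G 5) λ D → Rearranges C₂ D × (Positions.at D 3 ≡ x c) × (Positions.at D 2 ≡ x c')
  lineUp c c' c≢c' = moveInterior C₂ (colour-interior c) (colour-interior c')
                       (s≤s z≤n , ≤-refl) (s≤s z≤n , n≤1+n _) (λ e → c≢c' (suc-injective e)) (λ ())

  absorbAtOuterEdge : ∀ c c' → toℕ c ≢ toℕ c' → ∀ q → σ ≤ q → q < len C₁ →
                      Adj G (x c) (P₁.at q) → Adj G (x c') (P₁.at (suc q)) → Absorbed
  absorbAtOuterEdge c c' c≢c' q σ≤q q<n xc~q xc'~q+1 with lineUp c c' c≢c'
  ... | D , C₂D , D3≡xc , D2≡xc' =
        spliceAbsorbs C₁ D (rearranges-refl C₁) C₂D q<n ≤-refl (s≤s σ≤q) (m∸n≤m s 2)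
          (subst (Adj G (P₁.at q)) (≡.sym D3≡xc) (Graph.sym G xc~q))
          (subst (λ w → Adj G w (P₁.at (suc q))) (≡.sym D2≡xc') xc'~q+1)

  -- Moving u, v to the adjacent positions s-3, s-2 and splicing
  -- between them leaves a blob of size s - 2.
  absorbAtInnerPair : ∀ c c' → toℕ c ≢ toℕ c' → ∀ {u v} → InnerPair u v →
                      Adj G (x c) (P₁.at u) → Adj G (x c') (P₁.at v) → Absorbed
  absorbAtInnerPair c c' c≢c' (u-int , v-int , u≢v) xc~u xc'~v
    with lineUp c c' c≢c'
       | moveInterior C₁ u-int v-int (s≤s z≤n , n≤1+n _) (s≤s z≤n , ≤-refl) u≢v (λ e → 1+n≢n (≡.sym e))
  ... | D , C₂D , D3≡xc , D2≡xc' | C' , C₁C' , C'[s-3]≡u , C'[s-2]≡v =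
        spliceAbsorbs {s' = 18 + 6 * ℓ} {p = 17 + 6 * ℓ} C' D C₁C' C₂D
          (<-≤-trans (m≤n+m _ 2) (s≤len C')) (m≤n+m _ 2) ≤-refl ≤-refl
          (subst₂ (Adj G) (≡.sym C'[s-3]≡u) (≡.sym D3≡xc) (Graph.sym G xc~u))
          (subst₂ (Adj G) (≡.sym D2≡xc') (≡.sym C'[s-2]≡v) xc'~v)

  h = len C₁ / 2
  m = h ∸ ℓ

  private
    colour<5 : ∀ c → colour-pos c < 5
    colour<5 c = s≤s (≤-trans (toℕ<n c) (n≤1+n 3))
    colour<len : ∀ c → colour-pos c < len C₂
    colour<len c = <-≤-trans (colour<5 c) (s≤len C₂)
    nbrs : ∀ c → AtLeastNbrsOn G m (vert C₂ (fromℕ< (colour<len c))) C₁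
    nbrs c = many-nbrs _ (subst (_< 5) (≡.sym (toℕ-fromℕ< (colour<len c))) (colour<5 c))

  nbr : Fin 3 → Fin m → Fin (len C₁)
  nbr c = proj₁ (nbrs c)

  nbr-injective : ∀ c {t t'} → nbr c t ≡ nbr c t' → t ≡ t'
  nbr-injective c = proj₁ (proj₂ (nbrs c))

  nbr-adj : ∀ c t → Adj G (x c) (P₁.at (toℕ (nbr c t)))
  nbr-adj c t = subst₂ (Adj G) (≡.sym (P₂.at-< (colour<len c))) (≡.sym (P₁.at-toℕ (nbr c t)))
                  (proj₂ (proj₂ (nbrs c)) t)

  incidenceSlot : Fin 3 × Fin m → ℕ
  incidenceSlot (c , t) = slot (toℕ c) (toℕ (nbr c t))

  private
    colour≤2 : ∀ (c : Fin 3) → toℕ c ≤ 2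
    colour≤2 c = ≤-pred (toℕ<n c)

  incidenceSlot<slots : ∀ i → incidenceSlot i < slots
  incidenceSlot<slots (c , t) = slot-bound (colour≤2 c) (toℕ<n (nbr c t))

  slots<incidences : slots < 3 * m
  slots<incidences = slot-count ℓ z h (spread z) (spread-bound z) length-bound
    where
      σ≤n : σ ≤ len C₁
      σ≤n = ≤-trans (n≤1+n σ) (s≤len C₁)
      n≤2h+1 : len C₁ ≤ suc (2 * h)
      n≤2h+1 = subst (_≤ suc (2 * h)) (≡.sym (m≡m%n+[m/n]*n (len C₁) 2))
                 (+-mono-≤ (≤-pred (m%n<n (len C₁) 2)) (≤-reflexive (*-comm h 2)))
      length-bound : σ + z ≤ suc (2 * h)
      length-bound = subst (_≤ suc (2 * h)) (≡.sym (m+[n∸m]≡n σ≤n)) n≤2h+1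

  collision : ∀ i j → i ≢ j → incidenceSlot i ≡ incidenceSlot j → Absorbed
  collision (c , t) (c' , t') i≢j same with toℕ c ≟ toℕ c'
  ... | yes c≡c' with toℕ-injective c≡c'
  ...   | refl = ⊥-elim (i≢j (cong (c ,_) (nbr-injective c
                   (toℕ-injective (slot-injective (colour≤2 c) (toℕ<n (nbr c t)) (toℕ<n (nbr c t')) same)))))
  collision (c , t) (c' , t') i≢j same | no c≢c'
    with slot-collision (colour≤2 c) (colour≤2 c') c≢c' (toℕ<n (nbr c t)) (toℕ<n (nbr c' t')) same
  ... | inj₁ (q , σ≤q , q<n , q≡ , q+1≡) =
        absorbAtOuterEdge c c' c≢c' q σ≤q q<n
          (subst (Adj G (x c)) (≡.sym q≡) (nbr-adj c t)) (subst (Adj G (x c')) (≡.sym q+1≡) (nbr-adj c' t'))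
  ... | inj₂ (inj₁ (q , σ≤q , q<n , q≡ , q+1≡)) =
        absorbAtOuterEdge c' c (λ e → c≢c' (≡.sym e)) q σ≤q q<n
          (subst (Adj G (x c')) (≡.sym q≡) (nbr-adj c' t')) (subst (Adj G (x c)) (≡.sym q+1≡) (nbr-adj c t))
  ... | inj₂ (inj₂ inner-pair) = absorbAtInnerPair c c' c≢c' inner-pair (nbr-adj c t) (nbr-adj c' t')

lemma5p6 : ∀ (ℓ : ℕ) → ∃[ s ] (∀ {V : Set} (G : Graph V) (C₁ : BlobCycle G s) (C₂ : BlobCycle G 5)
             → VDisjoint C₁ C₂
             → (∀ (i : Fin (len C₂)) → toℕ i < 5 → AtLeastNbrsOn G ((len C₁ / 2) ∸ ℓ) (vert C₂ i) C₁)
             → ∃[ s′ ] Σ (BlobCycle G s′) λ C →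
                 (s ∸ 2 ≤ s′)
                 × (∀ v → (v ∈V C) ⇔ (v ∈V C₁ ⊎ v ∈V C₂))
                 × (∀ v → v ∈Blob C → v ∈Blob C₁))
lemma5p6 ℓ = 20 + 6 * ℓ , λ G C₁ C₂ disjoint many-nbrs →
  let open Absorption ℓ G C₁ C₂ disjoint many-nbrs
      (i , j , i≢j , same-slot) = pigeonhole-× incidenceSlot incidenceSlot<slots slots<incidences
  in collision i j i≢j same-slot
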